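{- Let $a^{\nearrow}_{n,k,\ell}$ be the number of non-decreasing Dyck paths with air pockets of length $n$ having $k$ up-steps $U$ and $\ell$ down-steps $D=D_1$, and $A^{\nearrow}(x,y,z)=\sum_{n,k,\ell\geq0}a^{\nearrow}_{n,k,\ell}x^ny^kz^\ell$. Then $$A^{\nearrow}(x,y,z)=\frac{x^2y(1-xy)(xyz-xy-z)(x^2yz+xy-1)}{\left(x^3y^2(z-1)+x^2y(y-z)-2xy+1\right)\left(x^3y^2(z-1)-x^2yz-xy+1\right)}.$$
   Context: A Dyck path with air pockets is a non-empty lattice path in the first quadrant starting at the origin, ending on the $x$-axis, with up-steps $U=(1,1)$ and down-steps $D_k=(1,-k)$, $k\ge1$, no two down-steps consecutive; $D=D_1$; its length is its number of steps. A valley is an occurrence of a factor $D_kU$ ($k\ge1$), and its height is the ordinate of the point between $D_k$ and $U$. The path is non-decreasing if the heights of its valleys, read from left to right, form a non-decreasing sequence. -}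

module Defs where

open import Data.Nat using (ℕ; zero; suc; _∸_; _≤ᵇ_; _≡ᵇ_)
open import Data.Bool using (Bool; true; false; _∧_; if_then_else_)
open import Data.List using (List; []; _∷_; [_]; _++_; map; concatMap; filter; length; upTo; foldr)
open import Data.Product using (_×_; _,_)
open import Data.Integer as ℤ using (ℤ; +_)
open import Relation.Nullary.Decidable using (Dec; yes; no)
open import Relation.Binary.PropositionalEquality using (_≡_; refl)

-- Steps: U = (1,1), and Dn k = D_k = (1,-k) (only k ≥ 1 is admissible;
-- this is enforced by the validity check below).
data Step : Set where
  U  : Step
  Dn : ℕ → Step

go : ℕ → Bool → List Step → Bool
go h _     []           = h ≡ᵇ 0
go h _     (U ∷ s)      = go (suc h) false s
go h true  (Dn k ∷ s)   = false
go h false (Dn k ∷ s)   = (1 ≤ᵇ k) ∧ ((k ≤ᵇ h) ∧ go (h ∸ k) true s)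

isDyckAP : List Step → Bool
isDyckAP []      = false
isDyckAP (x ∷ s) = go 0 false (x ∷ s)

valleyHeights : ℕ → List Step → List ℕ
valleyHeights h []                   = []
valleyHeights h (U ∷ s)              = valleyHeights (suc h) s
valleyHeights h (Dn k ∷ [])          = []
valleyHeights h (Dn k ∷ U ∷ s)       = (h ∸ k) ∷ valleyHeights (suc (h ∸ k)) s
valleyHeights h (Dn k ∷ Dn j ∷ s)    = valleyHeights (h ∸ k) (Dn j ∷ s)

nondecreasingList : List ℕ → Bool
nondecreasingList []           = true
nondecreasingList (a ∷ [])     = true
nondecreasingList (a ∷ b ∷ xs) = (a ≤ᵇ b) ∧ nondecreasingList (b ∷ xs)

isNonDecreasing : List Step → Bool
isNonDecreasing s = nondecreasingList (valleyHeights 0 s)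

countU : List Step → ℕ
countU []          = 0
countU (U ∷ s)     = suc (countU s)
countU (Dn _ ∷ s)  = countU s

countD1 : List Step → ℕ
countD1 []          = 0
countD1 (U ∷ s)     = countD1 s
countD1 (Dn k ∷ s)  = if k ≡ᵇ 1 then suc (countD1 s) else countD1 s

alphabet : ℕ → List Step
alphabet b = U ∷ map (λ i → Dn (suc i)) (upTo b)

words : ℕ → ℕ → List (List Step)
words b zero    = [ [] ]
words b (suc n) = concatMap (λ w → map (_∷ w) (alphabet b)) (words b n)

-- A path of length n has all its down-steps D_k with k ≤ n, so
-- words n n contains every Dyck path with air pockets of length n.

dec-true : (b : Bool) → Dec (b ≡ true)
dec-true true  = yes refl
dec-true false = no (λ ())

aND : ℕ → ℕ → ℕ → ℕ
aND n k ℓ = length (filter (λ p → dec-true (isDyckAP p ∧ (isNonDecreasing p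
                                   ∧ ((countU p ≡ᵇ k) ∧ (countD1 p ≡ᵇ ℓ)))))
                           (words n n))

-- Polynomials in x, y, z with integer coefficients, as lists of terms
-- (c , i , j , m) meaning c·x^i y^j z^m.

Poly : Set
Poly = List (ℤ × ℕ × ℕ × ℕ)

infixl 6 _+ₚ_ _-ₚ_
infixl 7 _*ₚ_

_+ₚ_ : Poly → Poly → Poly
p +ₚ q = p ++ q

negₚ : Poly → Poly
negₚ = map (λ { (c , t) → (ℤ.- c , t) })

_-ₚ_ : Poly → Poly → Poly
p -ₚ q = p +ₚ negₚ q

_*ₚ_ : Poly → Poly → Poly
p *ₚ q = concatMap (λ { (c , i , j , m) →
           map (λ { (d , i' , j' , m') → (c ℤ.* d , i Data.Nat.+ i' , j Data.Nat.+ j' , m Data.Nat.+ m') }) q }) p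
  where import Data.Nat

constₚ : ℤ → Poly
constₚ c = [ (c , 0 , 0 , 0) ]

X Y Z : Poly
X = [ (+ 1 , 1 , 0 , 0) ]
Y = [ (+ 1 , 0 , 1 , 0) ]
Z = [ (+ 1 , 0 , 0 , 1) ]

ONE : Poly
ONE = constₚ (+ 1)

sumℤ : List ℤ → ℤ
sumℤ = foldr ℤ._+_ (+ 0)

coeff : Poly → ℕ → ℕ → ℕ → ℤ
coeff p n k ℓ = sumℤ (map (λ { (c , i , j , m) →
                  if (i ≡ᵇ n) ∧ ((j ≡ᵇ k) ∧ (m ≡ᵇ ℓ)) then c else + 0 }) p)

-- coefficient of x^n y^k z^ℓ in the formal power series  p · Σ a(n,k,ℓ) x^n y^k z^ℓ
mulSeries : Poly → (ℕ → ℕ → ℕ → ℕ) → ℕ → ℕ → ℕ → ℤ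
mulSeries p a n k ℓ = sumℤ (map (λ { (c , i , j , m) →
                  if (i ≤ᵇ n) ∧ ((j ≤ᵇ k) ∧ (m ≤ᵇ ℓ))
                  then c ℤ.* (+ a (n ∸ i) (k ∸ j) (ℓ ∸ m)) else + 0 }) p)

numerator : Poly
numerator = X *ₚ X *ₚ Y *ₚ (ONE -ₚ X *ₚ Y)
            *ₚ (X *ₚ Y *ₚ Z -ₚ X *ₚ Y -ₚ Z)
            *ₚ (X *ₚ X *ₚ Y *ₚ Z +ₚ X *ₚ Y -ₚ ONE)

denom1 : Poly
denom1 = X *ₚ X *ₚ X *ₚ Y *ₚ Y *ₚ (Z -ₚ ONE)
         +ₚ X *ₚ X *ₚ Y *ₚ (Y -ₚ Z) -ₚ constₚ (+ 2) *ₚ X *ₚ Y +ₚ ONE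

denom2 : Poly
denom2 = X *ₚ X *ₚ X *ₚ Y *ₚ Y *ₚ (Z -ₚ ONE)
         -ₚ X *ₚ X *ₚ Y *ₚ Z -ₚ X *ₚ Y +ₚ ONE

module Submission where

open import Defs
open import Data.Nat using (ℕ)
open import Relation.Binary.PropositionalEquality using (_≡_; module ≡-Reasoning)

-- After an up-step at height f + g + 1, where f is the height of the
-- last valley (0 before the first one), the possible continuations depend only on g and on whether
-- f = 0: a down-step must land at height ≥ f (valley heights do not decrease) and be followed by an
-- up-step unless it ends the path. The generating functions F g and F₀ g of these continuations
-- satisfy F g = xy F (g + 1) + x + x²yz F 0 + g x²y F 0 and a similar recurrence for F₀.
-- Multiplying by (1 - xy)² and trying an answer affine in g solves them, because G g = xy G (g + 1)
-- + K g has at most one solution. This leaves linear equations in F 0, F₀ 0 and F₀ 1; eliminating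
-- them from A = xy F₀ 0 gives the rational function, up to a common factor 1 - xy.

module ValleyCounting where

  open import Data.Nat
  open import Data.Nat.Properties
  open import Data.Bool using (Bool; true; false; _∧_; if_then_else_)
  open import Data.Bool.Properties using (∧-assoc; ∧-zeroʳ; ∧-identityʳ; T-≡; ¬-not)
  open import Function.Bundles using (Equivalence)
  open import Data.List using (List; []; _∷_; _++_; map; concatMap; filter; length; applyUpTo)
  open import Data.Product using (_,_)
  open import Function using (_∘_; id)
  open import Relation.Binary.PropositionalEquality
  open import Data.Nat.Tactic.RingSolver using (solve-∀)

  ∑< : ℕ → (ℕ → ℕ) → ℕ
  ∑< zero    f = 0
  ∑< (suc n) f = f 0 + ∑< n (f ∘ suc)

  ∑<-cong : ∀ n {f g} → (∀ i → i < n → f i ≡ g i) → ∑< n f ≡ ∑< n g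
  ∑<-cong zero    e = refl
  ∑<-cong (suc n) e = cong₂ _+_ (e 0 z<s) (∑<-cong n (λ i i<n → e (suc i) (s<s i<n)))

  ∑<-zero : ∀ n {f} → (∀ i → i < n → f i ≡ 0) → ∑< n f ≡ 0
  ∑<-zero zero    e = refl
  ∑<-zero (suc n) e = cong₂ _+_ (e 0 z<s) (∑<-zero n (λ i i<n → e (suc i) (s<s i<n)))

  ∑<-const : ∀ n x → ∑< n (λ _ → x) ≡ n * x
  ∑<-const zero    x = refl
  ∑<-const (suc n) x = cong (x +_) (∑<-const n x)

  ∑<-+ : ∀ n f g → ∑< n (λ i → f i + g i) ≡ ∑< n f + ∑< n g
  ∑<-+ zero    f g = refl
  ∑<-+ (suc n) f g = trans (cong (f 0 + g 0 +_) (∑<-+ n (f ∘ suc) (g ∘ suc)))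
                           (swap (f 0) (g 0) (∑< n (f ∘ suc)) (∑< n (g ∘ suc)))
    where
    swap : ∀ a b c d → a + b + (c + d) ≡ a + c + (b + d)
    swap = solve-∀

  ∑<-+-range : ∀ m n f → ∑< (m + n) f ≡ ∑< m f + ∑< n (λ j → f (m + j))
  ∑<-+-range zero    n f = refl
  ∑<-+-range (suc m) n f = trans (cong (f 0 +_) (∑<-+-range m n (f ∘ suc))) (sym (+-assoc (f 0) _ _))

  ∑<-last : ∀ n f → ∑< (suc n) f ≡ ∑< n f + f n
  ∑<-last zero    f = +-comm (f 0) 0
  ∑<-last (suc n) f = trans (cong (f 0 +_) (∑<-last n (f ∘ suc))) (sym (+-assoc (f 0) _ _))

  ∑<-reverse : ∀ n f → ∑< n (λ i → f (n ∸ suc i)) ≡ ∑< n f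
  ∑<-reverse zero    f = refl
  ∑<-reverse (suc n) f = trans (cong (f n +_) (∑<-reverse n f)) (trans (+-comm (f n) _) (sym (∑<-last n f)))

  module _ {A : Set} where

    sumOver : List A → (A → ℕ) → ℕ
    sumOver []       f = 0
    sumOver (x ∷ xs) f = f x + sumOver xs f

    sumOver-cong : ∀ xs {f g} → (∀ x → f x ≡ g x) → sumOver xs f ≡ sumOver xs g
    sumOver-cong []       e = refl
    sumOver-cong (x ∷ xs) e = cong₂ _+_ (e x) (sumOver-cong xs e)

    sumOver-++ : ∀ xs ys f → sumOver (xs ++ ys) f ≡ sumOver xs f + sumOver ys f
    sumOver-++ []       ys f = refl
    sumOver-++ (x ∷ xs) ys f = trans (cong (f x +_) (sumOver-++ xs ys f)) (sym (+-assoc (f x) _ _))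

    sumOver-concatMap : ∀ (g : A → List A) xs f → sumOver (concatMap g xs) f ≡ sumOver xs (λ x → sumOver (g x) f)
    sumOver-concatMap g []       f = refl
    sumOver-concatMap g (x ∷ xs) f =
      trans (sumOver-++ (g x) (concatMap g xs) f) (cong (sumOver (g x) f +_) (sumOver-concatMap g xs f))

    sumOver-∑< : ∀ xs n (f : A → ℕ) (g : ℕ → A → ℕ) →
                 sumOver xs (λ x → f x + ∑< n (λ i → g i x)) ≡ sumOver xs f + ∑< n (λ i → sumOver xs (g i))
    sumOver-∑< []       n f g = sym (∑<-zero n (λ _ _ → refl))
    sumOver-∑< (x ∷ xs) n f g =
      trans (cong (f x + ∑< n (λ i → g i x) +_) (sumOver-∑< xs n f g))
      (trans (swap (f x) _ _ _) (cong (f x + sumOver xs f +_) (sym (∑<-+ n (λ i → g i x) (λ i → sumOver xs (g i))))))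
      where
      swap : ∀ a b c d → a + b + (c + d) ≡ a + c + (b + d)
      swap = solve-∀

  indicator : Bool → ℕ
  indicator true  = 1
  indicator false = 0

  countIn : (List Step → Bool) → List (List Step) → ℕ
  countIn P ws = sumOver ws (indicator ∘ P)

  length-filter : ∀ P ws → length (filter (λ w → dec-true (P w)) ws) ≡ countIn P ws
  length-filter P []       = refl
  length-filter P (w ∷ ws) with P w
  ... | true  = cong suc (length-filter P ws)
  ... | false = length-filter P ws

  countIn-cong : ∀ {P Q} ws → (∀ w → P w ≡ Q w) → countIn P ws ≡ countIn Q ws
  countIn-cong ws e = sumOver-cong ws (cong indicator ∘ e)

  countIn-none : ∀ {P} ws → (∀ w → P w ≡ false) → countIn P ws ≡ 0
  countIn-none []       e = refl
  countIn-none (w ∷ ws) e rewrite e w = countIn-none ws e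

  countIn-∧ : ∀ ok P ws → countIn (λ w → ok ∧ P w) ws ≡ (if ok then countIn P ws else 0)
  countIn-∧ true  P ws = refl
  countIn-∧ false P ws = countIn-none ws (λ _ → refl)

  countIn-words-suc : ∀ P b r → countIn P (words b (suc r)) ≡
    countIn (P ∘ (U ∷_)) (words b r) + ∑< b (λ i → countIn (P ∘ (Dn (suc i) ∷_)) (words b r))
  countIn-words-suc P b r =
    trans (sumOver-concatMap (λ w → map (_∷ w) (alphabet b)) (words b r) (indicator ∘ P))
    (trans (sumOver-cong (words b r) (λ w → cong (indicator (P (U ∷ w)) +_) (downSteps w id b)))
           (sumOver-∑< (words b r) b _ _))
    where
    downSteps : ∀ w (d : ℕ → ℕ) b →
                sumOver (map (_∷ w) (map (λ i → Dn (suc i)) (applyUpTo d b))) (indicator ∘ P)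
                ≡ ∑< b (λ i → indicator (P (Dn (suc (d i)) ∷ w)))
    downSteps w d zero    = refl
    downSteps w d (suc b) = cong (indicator (P (Dn (suc (d 0)) ∷ w)) +_) (downSteps w (d ∘ suc) b)

  -- countAfterUp c g r k ℓ counts the valid suffixes of length r with k steps U and ℓ steps D₁,
  -- read just after an up-step at height f + g + 1, where f is the height of the last valley
  -- (0 before the first one) and c records whether f = 0.
  countAfterUp countUpFirst countDownFirst : Bool → ℕ → ℕ → ℕ → ℕ → ℕ
  landingsBelowTop : Bool → ℕ → ℕ → ℕ → ℕ → ℕ
  landingOnTop : Bool → ℕ → ℕ → ℕ → ℕ

  countAfterUp c g zero    k ℓ = 0
  countAfterUp c g (suc r) k ℓ = countUpFirst c g r k ℓ + countDownFirst c g r k ℓ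

  countUpFirst c g r zero    ℓ = 0
  countUpFirst c g r (suc k) ℓ = countAfterUp c (suc g) r k ℓ

  -- A final down-step goes to the ground and is D₁ iff f = g = 0; any other down-step lands on one of
  -- f, …, f + g (by D₁ only on f + g) and is followed by an up-step.
  countDownFirst c g zero    zero    ℓ = indicator (ℓ ≡ᵇ indicator (c ∧ (g ≡ᵇ 0)))
  countDownFirst c g zero    (suc k) ℓ = 0
  countDownFirst c g (suc r) zero    ℓ = 0
  countDownFirst c g (suc r) (suc k) ℓ = landingsBelowTop c g r k ℓ + landingOnTop (c ∧ (g ≡ᵇ 0)) r k ℓ

  landingsBelowTop c zero    r k ℓ = 0
  landingsBelowTop c (suc g) r k ℓ = countAfterUp c 0 r k ℓ + g * countAfterUp false 0 r k ℓ

  landingOnTop c r k zero    = 0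
  landingOnTop c r k (suc ℓ) = countAfterUp c 0 r k ℓ

  countAfterDown : ℕ → ℕ → ℕ → ℕ → ℕ → ℕ
  countAfterDown zero    h f k       ℓ = indicator ((h ≡ᵇ 0) ∧ ((0 ≡ᵇ k) ∧ (0 ≡ᵇ ℓ)))
  countAfterDown (suc r) h f zero    ℓ = 0
  countAfterDown (suc r) h f (suc k) ℓ = if f ≤ᵇ h then countAfterUp (h ≡ᵇ 0) 0 r k ℓ else 0

  countAfterDownStep : ℕ → ℕ → ℕ → ℕ → ℕ → Bool → ℕ
  countAfterDownStep r h f k ℓ       false = countAfterDown r h f k ℓ
  countAfterDownStep r h f k zero    true  = 0
  countAfterDownStep r h f k (suc ℓ) true  = countAfterDown r h f k ℓ

  valleyHeightsAfterDown : ℕ → List Step → List ℕ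
  valleyHeightsAfterDown h []         = []
  valleyHeightsAfterDown h (U ∷ s)    = h ∷ valleyHeights (suc h) s
  valleyHeightsAfterDown h (Dn j ∷ s) = valleyHeights h (Dn j ∷ s)

  hasCounts : ℕ → ℕ → List Step → Bool
  hasCounts k ℓ s = (countU s ≡ᵇ k) ∧ (countD1 s ≡ᵇ ℓ)

  validAfterUp validAfterDown : ℕ → ℕ → ℕ → ℕ → List Step → Bool
  validAfterUp   h f k ℓ s = go h false s ∧ (nondecreasingList (f ∷ valleyHeights h s) ∧ hasCounts k ℓ s)
  validAfterDown h f k ℓ s = go h true s ∧ (nondecreasingList (f ∷ valleyHeightsAfterDown h s) ∧ hasCounts k ℓ s)

  validAfterDownStep : ℕ → ℕ → ℕ → ℕ → Bool → List Step → Bool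
  validAfterDownStep h f k ℓ       false = validAfterDown h f k ℓ
  validAfterDownStep h f k zero    true  = λ _ → false
  validAfterDownStep h f k (suc ℓ) true  = validAfterDown h f k ℓ

  ∧-∧-false : ∀ a b → a ∧ (b ∧ false) ≡ false
  ∧-∧-false a b = trans (cong (a ∧_) (∧-zeroʳ b)) (∧-zeroʳ a)

  validAfterUp-U-zero : ∀ h f ℓ s → validAfterUp h f 0 ℓ (U ∷ s) ≡ false
  validAfterUp-U-zero h f ℓ s = ∧-∧-false (go (suc h) false s) _

  validAfterDown-U-zero : ∀ h f ℓ s → validAfterDown h f 0 ℓ (U ∷ s) ≡ false
  validAfterDown-U-zero h f ℓ s = ∧-∧-false (go (suc h) false s) _

  validAfterDown-U : ∀ h f k ℓ s →
    validAfterDown h f (suc k) ℓ (U ∷ s) ≡ (f ≤ᵇ h) ∧ validAfterUp (suc h) h k ℓ s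
  validAfterDown-U h f k ℓ s with f ≤ᵇ h
  ... | true  = refl
  ... | false = ∧-zeroʳ _

  valleyHeights-Dn : ∀ h j s → valleyHeights h (Dn j ∷ s) ≡ valleyHeightsAfterDown (h ∸ j) s
  valleyHeights-Dn h j []         = refl
  valleyHeights-Dn h j (U ∷ s)    = refl
  valleyHeights-Dn h j (Dn x ∷ s) = refl

  validAfterUp-Dn : ∀ h f k ℓ i s →
    validAfterUp h f k ℓ (Dn (suc i) ∷ s) ≡ (suc i ≤ᵇ h) ∧ validAfterDownStep (h ∸ suc i) f k ℓ (i ≡ᵇ 0) s
  validAfterUp-Dn h f k ℓ i s rewrite valleyHeights-Dn h (suc i) s with i | ℓ
  ... | zero  | zero  =
    trans (cong (((1 ≤ᵇ h) ∧ go (h ∸ 1) true s) ∧_)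
                (∧-∧-false (nondecreasingList (f ∷ valleyHeightsAfterDown (h ∸ 1) s)) (countU s ≡ᵇ k)))
          (trans (∧-zeroʳ _) (sym (∧-zeroʳ (1 ≤ᵇ h))))
  ... | zero  | suc ℓ = ∧-assoc (1 ≤ᵇ h) _ _
  ... | suc i | ℓ     = ∧-assoc (suc (suc i) ≤ᵇ h) _ _

  ≤ᵇ-true : ∀ {i h} → i ≤ h → (i ≤ᵇ h) ≡ true
  ≤ᵇ-true i≤h = Equivalence.to T-≡ (≤⇒≤ᵇ i≤h)

  ≤ᵇ-false : ∀ {i h} → h < i → (i ≤ᵇ h) ≡ false
  ≤ᵇ-false {i} {h} h<i = ¬-not (λ i≤ᵇh → <⇒≱ h<i (≤ᵇ⇒≤ i h (Equivalence.from T-≡ i≤ᵇh)))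

  ≡ᵇ-refl : ∀ n → (n ≡ᵇ n) ≡ true
  ≡ᵇ-refl n = Equivalence.to T-≡ (≡⇒≡ᵇ n n refl)

  ≡ᵇ-false : ∀ {i j} → i ≢ j → (i ≡ᵇ j) ≡ false
  ≡ᵇ-false {i} {j} i≢j = ¬-not (i≢j ∘ ≡ᵇ⇒≡ i j ∘ Equivalence.from T-≡)

  ≡ᵇ-+ : ∀ f a b → (f + a ≡ᵇ f + b) ≡ (a ≡ᵇ b)
  ≡ᵇ-+ zero    a b = refl
  ≡ᵇ-+ (suc f) a b = ≡ᵇ-+ f a b

  +-≡ᵇ-0 : ∀ f j → (f + j ≡ᵇ 0) ≡ (f ≡ᵇ 0) ∧ (j ≡ᵇ 0)
  +-≡ᵇ-0 zero    j = refl
  +-≡ᵇ-0 (suc f) j = refl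

  ∑<-by-landing-height : ∀ b h (F : ℕ → Bool → ℕ) → h ≤ b →
    ∑< b (λ i → if suc i ≤ᵇ h then F (h ∸ suc i) (i ≡ᵇ 0) else 0) ≡ ∑< h (λ j → F j (suc j ≡ᵇ h))
  ∑<-by-landing-height b h F h≤b with m≤n⇒∃[o]m+o≡n h≤b
  ... | e , refl = begin
    ∑< (h + e) (λ i → if suc i ≤ᵇ h then F (h ∸ suc i) (i ≡ᵇ 0) else 0)
      ≡⟨ ∑<-+-range h e _ ⟩
    ∑< h (λ i → if suc i ≤ᵇ h then F (h ∸ suc i) (i ≡ᵇ 0) else 0)
      + ∑< e (λ i → if suc (h + i) ≤ᵇ h then F (h ∸ suc (h + i)) (h + i ≡ᵇ 0) else 0)
      ≡⟨ cong₂ _+_ (∑<-cong h (λ i i<h → cong (if_then F (h ∸ suc i) (i ≡ᵇ 0) else 0) (≤ᵇ-true i<h)))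
                   (∑<-zero e (λ i _ → cong (if_then F (h ∸ suc (h + i)) (h + i ≡ᵇ 0) else 0)
                                            (≤ᵇ-false (s≤s (m≤m+n h i))))) ⟩
    ∑< h (λ i → F (h ∸ suc i) (i ≡ᵇ 0)) + 0
      ≡⟨ +-identityʳ _ ⟩
    ∑< h (λ i → F (h ∸ suc i) (i ≡ᵇ 0))
      ≡⟨ ∑<-cong h (λ i i<h → cong (F (h ∸ suc i)) (D₁-iff-top h i i<h)) ⟩
    ∑< h (λ i → F (h ∸ suc i) (suc (h ∸ suc i) ≡ᵇ h))
      ≡⟨ ∑<-reverse h (λ j → F j (suc j ≡ᵇ h)) ⟩
    ∑< h (λ j → F j (suc j ≡ᵇ h)) ∎
    where
    open ≡-Reasoning
    D₁-iff-top : ∀ h i → i < h → (i ≡ᵇ 0) ≡ (suc (h ∸ suc i) ≡ᵇ h)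
    D₁-iff-top (suc h) zero    _             = sym (≡ᵇ-refl h)
    D₁-iff-top (suc h) (suc i) (s≤s i<h) = sym (≡ᵇ-false (<⇒≢ (∸-monoʳ-< z<s i<h)))

  countAfterDown-above-floor : ∀ r f j k ℓ →
    countAfterDown (suc r) (f + j) f (suc k) ℓ ≡ countAfterUp ((f ≡ᵇ 0) ∧ (j ≡ᵇ 0)) 0 r k ℓ
  countAfterDown-above-floor r f j k ℓ rewrite ≤ᵇ-true (m≤m+n f j) =
    cong (λ c → countAfterUp c 0 r k ℓ) (+-≡ᵇ-0 f j)

  countAfterDownStep-below-floor : ∀ r f j k ℓ top → j < f → countAfterDownStep (suc r) j f (suc k) ℓ top ≡ 0
  countAfterDownStep-below-floor r f j k ℓ       false j<f rewrite ≤ᵇ-false j<f = refl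
  countAfterDownStep-below-floor r f j k zero    true  j<f = refl
  countAfterDownStep-below-floor r f j k (suc ℓ) true  j<f rewrite ≤ᵇ-false j<f = refl

  ∑<-landingsBelowTop : ∀ c g r k ℓ →
    ∑< g (λ j → countAfterUp (c ∧ (j ≡ᵇ 0)) 0 r k ℓ) ≡ landingsBelowTop c g r k ℓ
  ∑<-landingsBelowTop c zero    r k ℓ = refl
  ∑<-landingsBelowTop c (suc g) r k ℓ =
    cong₂ _+_ (cong (λ c → countAfterUp c 0 r k ℓ) (∧-identityʳ c))
              (trans (∑<-cong g (λ j _ → cong (λ c → countAfterUp c 0 r k ℓ) (∧-zeroʳ c))) (∑<-const g _))

  ∑<-landings : ∀ r f g k ℓ →
    ∑< (f + suc g) (λ j → countAfterDownStep r j f k ℓ (suc j ≡ᵇ f + suc g))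
    ≡ countDownFirst (f ≡ᵇ 0) g r k ℓ
  ∑<-landings zero f g zero ℓ rewrite +-suc f g =
    trans (cong (countAfterDownStep 0 0 f 0 ℓ (0 ≡ᵇ f + g) +_)
                (∑<-zero (f + g) (λ j _ → off-ground j (suc j ≡ᵇ f + g) ℓ)))
          (trans (+-identityʳ _) (end-of-path f g ℓ))
    where
    off-ground : ∀ j top ℓ → countAfterDownStep 0 (suc j) f 0 ℓ top ≡ 0
    off-ground j false ℓ       = refl
    off-ground j true  zero    = refl
    off-ground j true  (suc ℓ) = refl
    end-of-path : ∀ f g ℓ → countAfterDownStep 0 0 f 0 ℓ (0 ≡ᵇ f + g) ≡ countDownFirst (f ≡ᵇ 0) g 0 0 ℓ
    end-of-path (suc f) g       zero          = refl
    end-of-path (suc f) g       (suc ℓ)       = refl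
    end-of-path zero    zero    zero          = refl
    end-of-path zero    zero    (suc zero)    = refl
    end-of-path zero    zero    (suc (suc ℓ)) = refl
    end-of-path zero    (suc g) zero          = refl
    end-of-path zero    (suc g) (suc ℓ)       = refl
  ∑<-landings zero f g (suc k) ℓ = ∑<-zero (f + suc g) (λ j _ → unfinished j (suc j ≡ᵇ f + suc g) ℓ)
    where
    unfinished : ∀ j top ℓ → countAfterDownStep 0 j f (suc k) ℓ top ≡ 0
    unfinished j false ℓ       = cong indicator (∧-zeroʳ (j ≡ᵇ 0))
    unfinished j true  zero    = refl
    unfinished j true  (suc ℓ) = cong indicator (∧-zeroʳ (j ≡ᵇ 0))
  ∑<-landings (suc r) f g zero ℓ = ∑<-zero (f + suc g) (λ j _ → no-up-step (suc j ≡ᵇ f + suc g) ℓ)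
    where
    no-up-step : ∀ top ℓ {j} → countAfterDownStep (suc r) j f 0 ℓ top ≡ 0
    no-up-step false ℓ       = refl
    no-up-step true  zero    = refl
    no-up-step true  (suc ℓ) = refl
  ∑<-landings (suc r) f g (suc k) ℓ = begin
    ∑< (f + suc g) (λ j → step j (suc j ≡ᵇ f + suc g))
      ≡⟨ ∑<-+-range f (suc g) _ ⟩
    ∑< f (λ j → step j (suc j ≡ᵇ f + suc g)) + ∑< (suc g) (λ j → step (f + j) (suc (f + j) ≡ᵇ f + suc g))
      ≡⟨ cong₂ _+_ (∑<-zero f (λ j j<f → countAfterDownStep-below-floor r f j k ℓ (suc j ≡ᵇ f + suc g) j<f))
                   (∑<-cong (suc g) (λ j _ → cong (step (f + j)) (top-iff j))) ⟩
    0 + ∑< (suc g) (λ j → step (f + j) (j ≡ᵇ g))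
      ≡⟨ ∑<-last g _ ⟩
    ∑< g (λ j → step (f + j) (j ≡ᵇ g)) + step (f + g) (g ≡ᵇ g)
      ≡⟨ cong₂ _+_ (∑<-cong g (λ j j<g → trans (cong (step (f + j)) (≡ᵇ-false (<⇒≢ j<g)))
                                              (countAfterDown-above-floor r f j k ℓ)))
                   (cong (step (f + g)) (≡ᵇ-refl g)) ⟩
    ∑< g (λ j → countAfterUp (c ∧ (j ≡ᵇ 0)) 0 r k ℓ) + step (f + g) true
      ≡⟨ cong₂ _+_ (∑<-landingsBelowTop c g r k ℓ) (on-top ℓ) ⟩
    landingsBelowTop c g r k ℓ + landingOnTop (c ∧ (g ≡ᵇ 0)) r k ℓ ∎
    where
    open ≡-Reasoning
    c = f ≡ᵇ 0
    step : ℕ → Bool → ℕ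
    step j top = countAfterDownStep (suc r) j f (suc k) ℓ top
    top-iff : ∀ j → (suc (f + j) ≡ᵇ f + suc g) ≡ (j ≡ᵇ g)
    top-iff j = trans (cong (_≡ᵇ f + suc g) (sym (+-suc f j))) (≡ᵇ-+ f (suc j) (suc g))
    on-top : ∀ ℓ → countAfterDownStep (suc r) (f + g) f (suc k) ℓ true ≡ landingOnTop (c ∧ (g ≡ᵇ 0)) r k ℓ
    on-top zero    = refl
    on-top (suc ℓ) = countAfterDown-above-floor r f g k ℓ

  -- The alphabet bound b ≥ h + r ensures every down-step of a valid suffix is available.
  countIn-validAfterUp : ∀ r g f h k ℓ b → h ≡ f + suc g → h + r ≤ b →
    countIn (validAfterUp h f k ℓ) (words b r) ≡ countAfterUp (f ≡ᵇ 0) g r k ℓ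
  countIn-validAfterDown : ∀ r h f k ℓ b → h + r ≤ b →
    countIn (validAfterDown h f k ℓ) (words b r) ≡ countAfterDown r h f k ℓ

  countIn-validAfterDownStep : ∀ r h f k ℓ top b → h + r ≤ b →
    countIn (validAfterDownStep h f k ℓ top) (words b r) ≡ countAfterDownStep r h f k ℓ top
  countIn-validAfterDownStep r h f k ℓ       false b le = countIn-validAfterDown r h f k ℓ b le
  countIn-validAfterDownStep r h f k zero    true  b le = countIn-none (words b r) (λ _ → refl)
  countIn-validAfterDownStep r h f k (suc ℓ) true  b le = countIn-validAfterDown r h f k ℓ b le

  countIn-validAfterDown zero    h f k ℓ b le = +-identityʳ _
  countIn-validAfterDown (suc r) h f k ℓ b le = begin
    countIn (validAfterDown h f k ℓ) (words b (suc r))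
      ≡⟨ countIn-words-suc (validAfterDown h f k ℓ) b r ⟩
    countIn (validAfterDown h f k ℓ ∘ (U ∷_)) (words b r) + ∑< b (λ i → countIn (λ _ → false) (words b r))
      ≡⟨ cong₂ _+_ (up k) (∑<-zero b (λ _ _ → countIn-none (words b r) (λ _ → refl))) ⟩
    countAfterDown (suc r) h f k ℓ + 0
      ≡⟨ +-identityʳ _ ⟩
    countAfterDown (suc r) h f k ℓ ∎
    where
    open ≡-Reasoning
    up : ∀ k → countIn (validAfterDown h f k ℓ ∘ (U ∷_)) (words b r) ≡ countAfterDown (suc r) h f k ℓ
    up zero    = countIn-none (words b r) (validAfterDown-U-zero h f ℓ)
    up (suc k) = begin
      countIn (validAfterDown h f (suc k) ℓ ∘ (U ∷_)) (words b r)
        ≡⟨ countIn-cong (words b r) (validAfterDown-U h f k ℓ) ⟩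
      countIn (λ s → (f ≤ᵇ h) ∧ validAfterUp (suc h) h k ℓ s) (words b r)
        ≡⟨ countIn-∧ (f ≤ᵇ h) (validAfterUp (suc h) h k ℓ) (words b r) ⟩
      (if f ≤ᵇ h then countIn (validAfterUp (suc h) h k ℓ) (words b r) else 0)
        ≡⟨ cong (if f ≤ᵇ h then_else 0)
                (countIn-validAfterUp r 0 h (suc h) k ℓ b (+-comm 1 h) (subst (_≤ b) (+-suc h r) le)) ⟩
      countAfterDown (suc r) h f (suc k) ℓ ∎

  countIn-validAfterUp zero    g f h k ℓ b refl le rewrite +-suc f g = refl
  countIn-validAfterUp (suc r) g f h k ℓ b refl le = begin
    countIn (validAfterUp h f k ℓ) (words b (suc r))
      ≡⟨ countIn-words-suc (validAfterUp h f k ℓ) b r ⟩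
    countIn (validAfterUp h f k ℓ ∘ (U ∷_)) (words b r)
      + ∑< b (λ i → countIn (validAfterUp h f k ℓ ∘ (Dn (suc i) ∷_)) (words b r))
      ≡⟨ cong₂ _+_ (up k) (∑<-cong b (λ i _ → down i)) ⟩
    countUpFirst c g r k ℓ
      + ∑< b (λ i → if suc i ≤ᵇ h then countAfterDownStep r (h ∸ suc i) f k ℓ (i ≡ᵇ 0) else 0)
      ≡⟨ cong (countUpFirst c g r k ℓ +_) (∑<-by-landing-height b h (λ j → countAfterDownStep r j f k ℓ) h≤b) ⟩
    countUpFirst c g r k ℓ + ∑< h (λ j → countAfterDownStep r j f k ℓ (suc j ≡ᵇ h))
      ≡⟨ cong (countUpFirst c g r k ℓ +_) (∑<-landings r f g k ℓ) ⟩
    countAfterUp c g (suc r) k ℓ ∎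
    where
    open ≡-Reasoning
    c = f ≡ᵇ 0
    h≤b : h ≤ b
    h≤b = ≤-trans (m≤m+n h (suc r)) le
    up : ∀ k → countIn (validAfterUp h f k ℓ ∘ (U ∷_)) (words b r) ≡ countUpFirst c g r k ℓ
    up zero    = countIn-none (words b r) (validAfterUp-U-zero h f ℓ)
    up (suc k) = countIn-validAfterUp r (suc g) f (suc h) k ℓ b (sym (+-suc f (suc g))) (subst (_≤ b) (+-suc h r) le)
    down : ∀ i → countIn (validAfterUp h f k ℓ ∘ (Dn (suc i) ∷_)) (words b r) ≡
                 (if suc i ≤ᵇ h then countAfterDownStep r (h ∸ suc i) f k ℓ (i ≡ᵇ 0) else 0)
    down i = begin
      countIn (validAfterUp h f k ℓ ∘ (Dn (suc i) ∷_)) (words b r)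
        ≡⟨ countIn-cong (words b r) (validAfterUp-Dn h f k ℓ i) ⟩
      countIn (λ s → (suc i ≤ᵇ h) ∧ validAfterDownStep (h ∸ suc i) f k ℓ (i ≡ᵇ 0) s) (words b r)
        ≡⟨ countIn-∧ (suc i ≤ᵇ h) (validAfterDownStep (h ∸ suc i) f k ℓ (i ≡ᵇ 0)) (words b r) ⟩
      (if suc i ≤ᵇ h then countIn (validAfterDownStep (h ∸ suc i) f k ℓ (i ≡ᵇ 0)) (words b r) else 0)
        ≡⟨ cong (if suc i ≤ᵇ h then_else 0)
                (countIn-validAfterDownStep r (h ∸ suc i) f k ℓ (i ≡ᵇ 0) b landing≤b) ⟩
      (if suc i ≤ᵇ h then countAfterDownStep r (h ∸ suc i) f k ℓ (i ≡ᵇ 0) else 0) ∎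
      where
      landing≤b : h ∸ suc i + r ≤ b
      landing≤b = ≤-trans (+-monoˡ-≤ r (m∸n≤m h (suc i))) (≤-trans (+-monoʳ-≤ h (n≤1+n r)) le)

  countPaths : ℕ → ℕ → ℕ → ℕ
  countPaths zero    k       ℓ = 0
  countPaths (suc r) zero    ℓ = 0
  countPaths (suc r) (suc k) ℓ = countAfterUp true 0 r k ℓ

  aND≡countPaths : ∀ n k ℓ → aND n k ℓ ≡ countPaths n k ℓ
  aND≡countPaths zero    k ℓ = refl
  aND≡countPaths (suc r) k ℓ = begin
    aND (suc r) k ℓ
      ≡⟨ length-filter (valid k) (words (suc r) (suc r)) ⟩
    countIn (valid k) (words (suc r) (suc r))
      ≡⟨ countIn-words-suc (valid k) (suc r) r ⟩
    countIn (valid k ∘ (U ∷_)) (words (suc r) r) + ∑< (suc r) (λ _ → countIn (λ _ → false) (words (suc r) r))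
      ≡⟨ cong₂ _+_ (first-up k) (∑<-zero (suc r) (λ _ _ → countIn-none (words (suc r) r) (λ _ → refl))) ⟩
    countPaths (suc r) k ℓ + 0
      ≡⟨ +-identityʳ _ ⟩
    countPaths (suc r) k ℓ ∎
    where
    open ≡-Reasoning
    valid : ℕ → List Step → Bool
    valid k p = isDyckAP p ∧ (isNonDecreasing p ∧ hasCounts k ℓ p)
    first-up : ∀ k → countIn (valid k ∘ (U ∷_)) (words (suc r) r) ≡ countPaths (suc r) k ℓ
    first-up zero    = countIn-none (words (suc r) r) (λ s → ∧-∧-false (go 1 false s) _)
    first-up (suc k) =
      trans (countIn-cong (words (suc r) r)
                          (λ s → cong (λ b → go 1 false s ∧ (b ∧ hasCounts k ℓ s))
                                      (sym (nondecreasing-0∷ (valleyHeights 1 s)))))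
            (countIn-validAfterUp r 0 0 1 k ℓ (suc r) refl ≤-refl)
      where
      nondecreasing-0∷ : ∀ xs → nondecreasingList (0 ∷ xs) ≡ nondecreasingList xs
      nondecreasing-0∷ []       = refl
      nondecreasing-0∷ (x ∷ xs) = refl

module PowerSeries where

  open import Data.Nat as ℕ using (ℕ; zero; suc)
  open import Data.Integer as ℤ using (ℤ; +_; +[1+_]; -[1+_]; _+_; _*_)
  open import Data.Integer.Properties
  open import Data.Integer.Tactic.RingSolver using (solve-∀)
  open import Data.Bool using (Bool; true; false; _∧_; _∨_; if_then_else_)
  open import Data.List using (List; []; _∷_; _++_; foldr)
  import Data.List as List
  open import Data.Product using (_×_; _,_)
  open import Function using (_∘_)
  open import Relation.Binary.Bundles using (Setoid)
  open import Relation.Binary.PropositionalEquality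
  open import Relation.Binary.Definitions using (DecidableEquality)
  open import Relation.Nullary using (yes; no)
  open import Data.Product.Properties using (≡-dec)
  open import Algebra.Bundles using (AbelianGroup)
  open import Algebra.Properties.Group (AbelianGroup.group +-0-abelianGroup) using (∙-cancelʳ)

  Series : Set
  Series = ℕ → ℕ → ℕ → ℤ

  infix 4 _≈_
  _≈_ : Series → Series → Set
  F ≈ G = ∀ n k ℓ → F n k ℓ ≡ G n k ℓ

  ≈-setoid : Setoid _ _
  ≈-setoid = record
    { Carrier = Series
    ; _≈_ = _≈_
    ; isEquivalence = record
      { refl = λ _ _ _ → refl
      ; sym = λ e n k ℓ → sym (e n k ℓ)
      ; trans = λ e e′ n k ℓ → trans (e n k ℓ) (e′ n k ℓ)
      }
    }

  open Setoid ≈-setoid public using () renaming (refl to ≈-refl; sym to ≈-sym; trans to ≈-trans)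

  0ˢ : Series
  0ˢ _ _ _ = + 0

  infixl 6 _⊕_
  _⊕_ : Series → Series → Series
  (F ⊕ G) n k ℓ = F n k ℓ + G n k ℓ

  -- The scalar is the right factor: + 0 * x computes to + 0, whereas x * + 0 does not.
  infixr 7 _·ˢ_
  _·ˢ_ : ℕ → Series → Series
  (g ·ˢ F) n k ℓ = F n k ℓ * + g

  ⊕-cong : ∀ {F F′ G G′} → F ≈ F′ → G ≈ G′ → F ⊕ G ≈ F′ ⊕ G′
  ⊕-cong e e′ n k ℓ = cong₂ _+_ (e n k ℓ) (e′ n k ℓ)

  ⊕-cancelʳ : ∀ {F G H} → F ⊕ H ≈ G ⊕ H → F ≈ G
  ⊕-cancelʳ {H = H} e n k ℓ = ∙-cancelʳ (H n k ℓ) _ _ (e n k ℓ)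

  ⊕-assoc : ∀ F G H → F ⊕ G ⊕ H ≈ F ⊕ (G ⊕ H)
  ⊕-assoc F G H n k ℓ = +-assoc (F n k ℓ) (G n k ℓ) (H n k ℓ)

  -- shift i f is the coefficient sequence of tⁱ · f
  shift : ℕ → (ℕ → ℤ) → ℕ → ℤ
  shift zero    f n       = f n
  shift (suc i) f zero    = + 0
  shift (suc i) f (suc n) = shift i f n

  shift-cong : ∀ i {f g} → (∀ a → f a ≡ g a) → ∀ n → shift i f n ≡ shift i g n
  shift-cong zero    e n       = e n
  shift-cong (suc i) e zero    = refl
  shift-cong (suc i) e (suc n) = shift-cong i e n

  shift-+ : ∀ i f g n → shift i (λ a → f a + g a) n ≡ shift i f n + shift i g n
  shift-+ zero    f g n       = refl
  shift-+ (suc i) f g zero    = refl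
  shift-+ (suc i) f g (suc n) = shift-+ i f g n

  shift-map : (φ : ℤ → ℤ) → φ (+ 0) ≡ + 0 → ∀ i f n → shift i (φ ∘ f) n ≡ φ (shift i f n)
  shift-map φ z zero    f n       = refl
  shift-map φ z (suc i) f zero    = sym z
  shift-map φ z (suc i) f (suc n) = shift-map φ z i f n

  shift-shift : ∀ i i′ f n → shift (i ℕ.+ i′) f n ≡ shift i (shift i′ f) n
  shift-shift zero    i′ f n       = refl
  shift-shift (suc i) i′ f zero    = refl
  shift-shift (suc i) i′ f (suc n) = shift-shift i i′ f n

  shift-comm : ∀ i j (G : ℕ → ℕ → ℤ) n k →
               shift i (λ a → shift j (G a) k) n ≡ shift j (λ b → shift i (λ a → G a b) n) k
  shift-comm zero    j G n       k = refl
  shift-comm (suc i) zero G n k = refl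
  shift-comm (suc i) (suc j) G zero    zero    = refl
  shift-comm (suc i) (suc j) G zero    (suc k) = shift-comm (suc i) j (λ a → G a ∘ suc) zero k
  shift-comm (suc i) (suc j) G (suc n) k = shift-comm i (suc j) G n k

  monomial : ℕ → ℕ → ℕ → Series → Series
  monomial i j m F n k ℓ = shift i (λ a → shift j (λ b → shift m (F a b) ℓ) k) n

  monomial-cong : ∀ i j m {F G} → F ≈ G → monomial i j m F ≈ monomial i j m G
  monomial-cong i j m e n k ℓ = shift-cong i (λ a → shift-cong j (λ b → shift-cong m (e a b) ℓ) k) n

  monomial-⊕ : ∀ i j m F G → monomial i j m (F ⊕ G) ≈ monomial i j m F ⊕ monomial i j m G
  monomial-⊕ i j m F G n k ℓ =
    trans (shift-cong i (λ a → trans (shift-cong j (λ b → shift-+ m (F a b) (G a b) ℓ) k) (shift-+ j _ _ k)) n)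
          (shift-+ i _ _ n)

  monomial-map : (φ : ℤ → ℤ) → φ (+ 0) ≡ + 0 → ∀ i j m F n k ℓ →
                 monomial i j m (λ a b c → φ (F a b c)) n k ℓ ≡ φ (monomial i j m F n k ℓ)
  monomial-map φ z i j m F n k ℓ =
    trans (shift-cong i (λ a → trans (shift-cong j (λ b → shift-map φ z m (F a b) ℓ) k)
                                     (shift-map φ z j _ k)) n)
          (shift-map φ z i _ n)

  monomial-+ : ∀ i i′ j j′ m m′ F →
               monomial (i ℕ.+ i′) (j ℕ.+ j′) (m ℕ.+ m′) F ≈ monomial i j m (monomial i′ j′ m′ F)
  monomial-+ i i′ j j′ m m′ F n k ℓ =
    trans (shift-shift i i′ _ n) (shift-cong i (λ a →
      trans (shift-cong i′ (λ a′ → trans (shift-shift j j′ _ k)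
                                     (shift-cong j (λ b → shift-cong j′ (λ b′ → shift-shift m m′ (F a′ b′) ℓ) b) k)) a)
      (trans (shift-comm i′ j (λ a′ b → shift j′ (λ b′ → shift m (shift m′ (F a′ b′)) ℓ) b) a k)
      (shift-cong j (λ b →
         trans (shift-cong i′ (λ a′ → shift-comm j′ m (λ b′ → shift m′ (F a′ b′)) b ℓ) a)
               (shift-comm i′ m (λ a′ c → shift j′ (λ b′ → shift m′ (F a′ b′) c) b) a ℓ)) k))) n)

  0ₚ : Poly
  0ₚ = []

  infixr 7 _⋆_
  _⋆_ : Poly → Series → Series
  ([] ⋆ F) n k ℓ = + 0
  (((c , i , j , m) ∷ p) ⋆ F) n k ℓ = c * monomial i j m F n k ℓ + (p ⋆ F) n k ℓ

  ⋆-cong : ∀ p {F G} → F ≈ G → p ⋆ F ≈ p ⋆ G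
  ⋆-cong []                    e n k ℓ = refl
  ⋆-cong ((c , i , j , m) ∷ p) e n k ℓ = cong₂ _+_ (cong (c *_) (monomial-cong i j m e n k ℓ)) (⋆-cong p e n k ℓ)

  ⋆-++ : ∀ p q F → (p ++ q) ⋆ F ≈ p ⋆ F ⊕ q ⋆ F
  ⋆-++ []      q F n k ℓ = sym (+-identityˡ _)
  ⋆-++ ((c , i , j , m) ∷ p) q F n k ℓ =
    trans (cong (λ z → c * monomial i j m F n k ℓ + z) (⋆-++ p q F n k ℓ))
          (sym (+-assoc (c * monomial i j m F n k ℓ) ((p ⋆ F) n k ℓ) ((q ⋆ F) n k ℓ)))

  ⋆-⊕ : ∀ p F G → p ⋆ (F ⊕ G) ≈ p ⋆ F ⊕ p ⋆ G
  ⋆-⊕ []                    F G n k ℓ = refl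
  ⋆-⊕ ((c , i , j , m) ∷ p) F G n k ℓ =
    trans (cong₂ _+_ (cong (c *_) (monomial-⊕ i j m F G n k ℓ)) (⋆-⊕ p F G n k ℓ))
          (distrib c (monomial i j m F n k ℓ) (monomial i j m G n k ℓ) _ _)
    where
    distrib : ∀ c a b x y → c * (a + b) + (x + y) ≡ (c * a + x) + (c * b + y)
    distrib = solve-∀

  ⋆-0ˢ : ∀ p → p ⋆ 0ˢ ≈ 0ˢ
  ⋆-0ˢ []                    n k ℓ = refl
  ⋆-0ˢ ((c , i , j , m) ∷ p) n k ℓ =
    cong₂ _+_ (trans (cong (c *_) (monomial-map (λ _ → + 0) refl i j m 0ˢ n k ℓ)) (*-zeroʳ c)) (⋆-0ˢ p n k ℓ)

  -- The term map of _*ₚ_, so that ((c , i , j , m) ∷ p) *ₚ q ≡ map (scaleTerm c i j m) q ++ p *ₚ q.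
  scaleTerm : ℤ → ℕ → ℕ → ℕ → ℤ × ℕ × ℕ × ℕ → ℤ × ℕ × ℕ × ℕ
  scaleTerm c i j m (d , i′ , j′ , m′) = (c * d , i ℕ.+ i′ , j ℕ.+ j′ , m ℕ.+ m′)

  scaleTerm-⋆ : ∀ c i j m q F n k ℓ →
                (List.map (scaleTerm c i j m) q ⋆ F) n k ℓ ≡ c * monomial i j m (q ⋆ F) n k ℓ
  scaleTerm-⋆ c i j m [] F n k ℓ = sym (trans (cong (c *_) (monomial-map (λ _ → + 0) refl i j m F n k ℓ)) (*-zeroʳ c))
  scaleTerm-⋆ c i j m ((d , i′ , j′ , m′) ∷ q) F n k ℓ = begin
    c * d * monomial (i ℕ.+ i′) (j ℕ.+ j′) (m ℕ.+ m′) F n k ℓ + (List.map (scaleTerm c i j m) q ⋆ F) n k ℓ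
      ≡⟨ cong₂ _+_ (cong (c * d *_) (monomial-+ i i′ j j′ m m′ F n k ℓ)) (scaleTerm-⋆ c i j m q F n k ℓ) ⟩
    c * d * monomial i j m M n k ℓ + c * monomial i j m (q ⋆ F) n k ℓ
      ≡⟨ distrib c d _ _ ⟩
    c * (d * monomial i j m M n k ℓ + monomial i j m (q ⋆ F) n k ℓ)
      ≡⟨ cong (c *_) (sym (trans (monomial-⊕ i j m (λ a b e → d * M a b e) (q ⋆ F) n k ℓ)
                                 (cong₂ _+_ (monomial-map (d *_) (*-zeroʳ d) i j m M n k ℓ) refl))) ⟩
    c * monomial i j m (((d , i′ , j′ , m′) ∷ q) ⋆ F) n k ℓ ∎
    where
    open ≡-Reasoning
    M : Series
    M = monomial i′ j′ m′ F
    distrib : ∀ c d a b → c * d * a + c * b ≡ c * (d * a + b)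
    distrib = solve-∀

  ⋆-*ₚ : ∀ p q F → (p *ₚ q) ⋆ F ≈ p ⋆ (q ⋆ F)
  ⋆-*ₚ []                    q F n k ℓ = refl
  ⋆-*ₚ ((c , i , j , m) ∷ p) q F n k ℓ =
    trans (⋆-++ (List.map (scaleTerm c i j m) q) (p *ₚ q) F n k ℓ)
          (cong₂ _+_ (scaleTerm-⋆ c i j m q F n k ℓ) (⋆-*ₚ p q F n k ℓ))

  ONE-⋆ : ∀ F → ONE ⋆ F ≈ F
  ONE-⋆ F n k ℓ = trans (+-identityʳ _) (*-identityˡ _)

  δ : Series
  δ zero zero zero = + 1
  δ _    _    _    = + 0

  shift-≤ᵇ : ∀ i f n → shift i f n ≡ (if i ℕ.≤ᵇ n then f (n ℕ.∸ i) else + 0)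
  shift-≤ᵇ zero          f n       = refl
  shift-≤ᵇ (suc i)       f zero    = refl
  shift-≤ᵇ (suc zero)    f (suc n) = refl
  shift-≤ᵇ (suc (suc i)) f (suc n) = shift-≤ᵇ (suc i) f n

  shift-point : ∀ i f n → (∀ a → f (suc a) ≡ + 0) → shift i f n ≡ (if i ℕ.≡ᵇ n then f 0 else + 0)
  shift-point zero    f zero    _ = refl
  shift-point zero    f (suc n) z = z n
  shift-point (suc i) f zero    _ = refl
  shift-point (suc i) f (suc n) z = shift-point i f n z

  shift-0 : ∀ i n → shift i (λ _ → + 0) n ≡ + 0
  shift-0 i n = shift-map (λ _ → + 0) refl i (λ _ → + 0) n

  if-∧ : ∀ b₁ b₂ b₃ (x : ℤ) →
         (if b₁ then (if b₂ then (if b₃ then x else + 0) else + 0) else + 0)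
         ≡ (if b₁ ∧ (b₂ ∧ b₃) then x else + 0)
  if-∧ true  true  b₃ x = refl
  if-∧ true  false b₃ x = refl
  if-∧ false b₂    b₃ x = refl

  monomial-≤ᵇ : ∀ i j m F n k ℓ → monomial i j m F n k ℓ ≡
    (if (i ℕ.≤ᵇ n) ∧ ((j ℕ.≤ᵇ k) ∧ (m ℕ.≤ᵇ ℓ)) then F (n ℕ.∸ i) (k ℕ.∸ j) (ℓ ℕ.∸ m) else + 0)
  monomial-≤ᵇ i j m F n k ℓ =
    trans (shift-cong i (λ a → trans (shift-cong j (λ b → shift-≤ᵇ m (F a b) ℓ) k) (shift-≤ᵇ j _ k)) n)
          (trans (shift-≤ᵇ i _ n) (if-∧ (i ℕ.≤ᵇ n) (j ℕ.≤ᵇ k) (m ℕ.≤ᵇ ℓ) _))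

  monomial-δ : ∀ i j m n k ℓ → monomial i j m δ n k ℓ ≡
    (if (i ℕ.≡ᵇ n) ∧ ((j ℕ.≡ᵇ k) ∧ (m ℕ.≡ᵇ ℓ)) then + 1 else + 0)
  monomial-δ i j m n k ℓ =
    trans (shift-point i _ n (λ a → trans (shift-cong j (λ b → shift-0 m ℓ) k) (shift-0 j k)))
    (trans (cong (if i ℕ.≡ᵇ n then_else + 0)
                 (trans (shift-point j _ k (λ b → shift-0 m ℓ))
                        (cong (if j ℕ.≡ᵇ k then_else + 0) (shift-point m _ ℓ (λ _ → refl)))))
           (if-∧ (i ℕ.≡ᵇ n) (j ℕ.≡ᵇ k) (m ℕ.≡ᵇ ℓ) (+ 1)))

  mulSeries-⋆ : ∀ p a n k ℓ → mulSeries p a n k ℓ ≡ (p ⋆ (λ n k ℓ → + a n k ℓ)) n k ℓ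
  mulSeries-⋆ []                    a n k ℓ = refl
  mulSeries-⋆ ((c , i , j , m) ∷ p) a n k ℓ =
    cong₂ _+_ (trans (pull-c ((i ℕ.≤ᵇ n) ∧ ((j ℕ.≤ᵇ k) ∧ (m ℕ.≤ᵇ ℓ))))
                     (cong (c *_) (sym (monomial-≤ᵇ i j m (λ n k ℓ → + a n k ℓ) n k ℓ))))
              (mulSeries-⋆ p a n k ℓ)
    where
    pull-c : ∀ b → (if b then c * + a (n ℕ.∸ i) (k ℕ.∸ j) (ℓ ℕ.∸ m) else + 0) ≡
                   c * (if b then + a (n ℕ.∸ i) (k ℕ.∸ j) (ℓ ℕ.∸ m) else + 0)
    pull-c true  = refl
    pull-c false = sym (*-zeroʳ c)

  coeff-⋆ : ∀ p n k ℓ → coeff p n k ℓ ≡ (p ⋆ δ) n k ℓ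
  coeff-⋆ []                    n k ℓ = refl
  coeff-⋆ ((c , i , j , m) ∷ p) n k ℓ =
    cong₂ _+_ (trans (pull-c ((i ℕ.≡ᵇ n) ∧ ((j ℕ.≡ᵇ k) ∧ (m ℕ.≡ᵇ ℓ))))
                     (cong (c *_) (sym (monomial-δ i j m n k ℓ))))
              (coeff-⋆ p n k ℓ)
    where
    pull-c : ∀ b → (if b then c else + 0) ≡ c * (if b then + 1 else + 0)
    pull-c true  = sym (*-identityʳ c)
    pull-c false = sym (*-zeroʳ c)

  Exponent : Set
  Exponent = ℕ × ℕ × ℕ

  _≟ᵉ_ : DecidableEquality Exponent
  _≟ᵉ_ = ≡-dec ℕ._≟_ (≡-dec ℕ._≟_ ℕ._≟_)

  _<ᵉ_ : Exponent → Exponent → Bool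
  (i , j , m) <ᵉ (i′ , j′ , m′) =
    (i ℕ.<ᵇ i′) ∨ ((i ℕ.≡ᵇ i′) ∧ ((j ℕ.<ᵇ j′) ∨ ((j ℕ.≡ᵇ j′) ∧ (m ℕ.<ᵇ m′))))

  insertTerm : ℤ × Exponent → Poly → Poly
  insertTerm t [] = t ∷ []
  insertTerm (c , e) ((d , e′) ∷ p) with e ≟ᵉ e′
  ... | yes _ = (c + d , e′) ∷ p
  ... | no  _ = if e <ᵉ e′ then (c , e) ∷ (d , e′) ∷ p else (d , e′) ∷ insertTerm (c , e) p

  dropZeros : Poly → Poly
  dropZeros []                = []
  dropZeros ((+ 0 , e) ∷ p)   = dropZeros p
  dropZeros (t ∷ p)           = t ∷ dropZeros p

  normalise : Poly → Poly
  normalise p = dropZeros (foldr insertTerm [] p)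

  insertTerm-⋆ : ∀ t p F → insertTerm t p ⋆ F ≈ (t ∷ p) ⋆ F
  insertTerm-⋆ t [] F n k ℓ = refl
  insertTerm-⋆ (c , e) ((d , e′) ∷ p) F n k ℓ with e ≟ᵉ e′
  insertTerm-⋆ (c , i , j , m) ((d , _) ∷ p) F n k ℓ | yes refl =
    trans (cong (_+ (p ⋆ F) n k ℓ) (*-distribʳ-+ (monomial i j m F n k ℓ) c d))
          (+-assoc (c * monomial i j m F n k ℓ) (d * monomial i j m F n k ℓ) ((p ⋆ F) n k ℓ))
  insertTerm-⋆ (c , e) ((d , e′) ∷ p) F n k ℓ | no _ with e <ᵉ e′
  ... | true  = refl
  insertTerm-⋆ (c , i , j , m) ((d , i′ , j′ , m′) ∷ p) F n k ℓ | no _ | false =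
    trans (cong (λ z → d * monomial i′ j′ m′ F n k ℓ + z) (insertTerm-⋆ (c , i , j , m) p F n k ℓ))
          (swap (d * monomial i′ j′ m′ F n k ℓ) (c * monomial i j m F n k ℓ) ((p ⋆ F) n k ℓ))
    where
    swap : ∀ a b x → a + (b + x) ≡ b + (a + x)
    swap = solve-∀

  dropZeros-⋆ : ∀ p F → dropZeros p ⋆ F ≈ p ⋆ F
  dropZeros-⋆ [] F n k ℓ = refl
  dropZeros-⋆ ((+ 0 , e) ∷ p) F n k ℓ = trans (dropZeros-⋆ p F n k ℓ) (sym (+-identityˡ _))
  dropZeros-⋆ ((+[1+ c ] , i , j , m) ∷ p) F n k ℓ =
    cong (λ z → +[1+ c ] * monomial i j m F n k ℓ + z) (dropZeros-⋆ p F n k ℓ)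
  dropZeros-⋆ ((-[1+ c ] , i , j , m) ∷ p) F n k ℓ =
    cong (λ z → -[1+ c ] * monomial i j m F n k ℓ + z) (dropZeros-⋆ p F n k ℓ)

  normalise-⋆ : ∀ p F → normalise p ⋆ F ≈ p ⋆ F
  normalise-⋆ p F n k ℓ = trans (dropZeros-⋆ (foldr insertTerm [] p) F n k ℓ) (sorted p n k ℓ)
    where
    sorted : ∀ p → foldr insertTerm [] p ⋆ F ≈ p ⋆ F
    sorted []                    n k ℓ = refl
    sorted ((c , i , j , m) ∷ p) n k ℓ =
      trans (insertTerm-⋆ (c , i , j , m) (foldr insertTerm [] p) F n k ℓ)
            (cong (λ z → c * monomial i j m F n k ℓ + z) (sorted p n k ℓ))

  ⋆-normal-form : ∀ p q → normalise p ≡ normalise q → ∀ F → p ⋆ F ≈ q ⋆ F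
  ⋆-normal-form p q e F n k ℓ =
    trans (sym (normalise-⋆ p F n k ℓ)) (trans (cong (λ r → (r ⋆ F) n k ℓ) e) (normalise-⋆ q F n k ℓ))

module LinearCombinations where

  open PowerSeries
  open import Data.Integer using (_+_)
  open import Data.Integer.Properties using (+-identityˡ; +-identityʳ)
  open import Data.Integer.Tactic.RingSolver using (solve-∀)
  open import Data.Vec as Vec using (Vec; []; _∷_; zipWith; replicate; lookup; _[_]≔_)
  open import Data.Vec.Properties using (∷-injectiveˡ; ∷-injectiveʳ)
  open import Data.Fin as Fin using (Fin)
  open import Relation.Binary.PropositionalEquality

  infixl 6 _+ᵛ_
  infixr 7 _*ᵛ_
  infix 8 _∙_

  _+ᵛ_ : ∀ {m} → Vec Poly m → Vec Poly m → Vec Poly m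
  _+ᵛ_ = zipWith _+ₚ_

  _*ᵛ_ : ∀ {m} → Poly → Vec Poly m → Vec Poly m
  p *ᵛ v = Vec.map (p *ₚ_) v

  _∙_ : ∀ {m} → Vec Poly m → Vec Series m → Series
  []      ∙ []      = 0ˢ
  (p ∷ v) ∙ (F ∷ B) = p ⋆ F ⊕ v ∙ B

  ∙-+ᵛ : ∀ {m} (u v : Vec Poly m) B → (u +ᵛ v) ∙ B ≈ u ∙ B ⊕ v ∙ B
  ∙-+ᵛ []      []      []      n k ℓ = refl
  ∙-+ᵛ (p ∷ u) (q ∷ v) (F ∷ B) n k ℓ =
    trans (cong₂ _+_ (⋆-++ p q F n k ℓ) (∙-+ᵛ u v B n k ℓ))
          (swap ((p ⋆ F) n k ℓ) ((q ⋆ F) n k ℓ) ((u ∙ B) n k ℓ) ((v ∙ B) n k ℓ))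
    where
    swap : ∀ a b x y → (a + b) + (x + y) ≡ (a + x) + (b + y)
    swap = solve-∀

  ∙-*ᵛ : ∀ {m} p (v : Vec Poly m) B → (p *ᵛ v) ∙ B ≈ p ⋆ (v ∙ B)
  ∙-*ᵛ p []      []      n k ℓ = sym (⋆-0ˢ p n k ℓ)
  ∙-*ᵛ p (q ∷ v) (F ∷ B) n k ℓ =
    trans (cong₂ _+_ (⋆-*ₚ p q F n k ℓ) (∙-*ᵛ p v B n k ℓ)) (sym (⋆-⊕ p (q ⋆ F) (v ∙ B) n k ℓ))

  ∙-normal-form : ∀ {m} (u v : Vec Poly m) → Vec.map normalise u ≡ Vec.map normalise v → ∀ B → u ∙ B ≈ v ∙ B
  ∙-normal-form []      []      e []      n k ℓ = refl
  ∙-normal-form (p ∷ u) (q ∷ v) e (F ∷ B) n k ℓ =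
    cong₂ _+_ (⋆-normal-form p q (∷-injectiveˡ e) F n k ℓ) (∙-normal-form u v (∷-injectiveʳ e) B n k ℓ)

  ∙-unit : ∀ {m} (i : Fin m) p B → (replicate m 0ₚ [ i ]≔ p) ∙ B ≈ p ⋆ lookup B i
  ∙-unit Fin.zero    p (F ∷ B) n k ℓ =
    trans (cong (λ z → (p ⋆ F) n k ℓ + z) (zeros-∙ B n k ℓ)) (+-identityʳ _)
    where
    zeros-∙ : ∀ {m} (B : Vec Series m) → replicate m 0ₚ ∙ B ≈ 0ˢ
    zeros-∙ []      n k ℓ = refl
    zeros-∙ (F ∷ B) n k ℓ = trans (+-identityˡ _) (zeros-∙ B n k ℓ)
  ∙-unit (Fin.suc i) p (F ∷ B) n k ℓ = trans (+-identityˡ _) (∙-unit i p B n k ℓ)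

  module _ {m} (B : Vec Series m) where
    open import Relation.Binary.Reasoning.Setoid ≈-setoid

    ∙-relation-*ᵛ : ∀ c (l r : Vec Poly m) → l ∙ B ≈ r ∙ B → (c *ᵛ l) ∙ B ≈ (c *ᵛ r) ∙ B
    ∙-relation-*ᵛ c l r e = begin
      (c *ᵛ l) ∙ B  ≈⟨ ∙-*ᵛ c l B ⟩
      c ⋆ (l ∙ B)   ≈⟨ ⋆-cong c e ⟩
      c ⋆ (r ∙ B)   ≈⟨ ≈-sym (∙-*ᵛ c r B) ⟩
      (c *ᵛ r) ∙ B  ∎

    ∙-relation-+ᵛ : ∀ (l r l′ r′ : Vec Poly m) → l ∙ B ≈ r ∙ B → l′ ∙ B ≈ r′ ∙ B →
                    (l +ᵛ l′) ∙ B ≈ (r +ᵛ r′) ∙ B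
    ∙-relation-+ᵛ l r l′ r′ e e′ = begin
      (l +ᵛ l′) ∙ B     ≈⟨ ∙-+ᵛ l l′ B ⟩
      l ∙ B ⊕ l′ ∙ B    ≈⟨ ⊕-cong e e′ ⟩
      r ∙ B ⊕ r′ ∙ B    ≈⟨ ≈-sym (∙-+ᵛ r r′ B) ⟩
      (r +ᵛ r′) ∙ B     ∎

    ∙-by-relation : ∀ (l r u v : Vec Poly m) → l ∙ B ≈ r ∙ B →
                    Vec.map normalise (u +ᵛ r) ≡ Vec.map normalise (v +ᵛ l) → u ∙ B ≈ v ∙ B
    ∙-by-relation l r u v e certificate = ⊕-cancelʳ (begin
      u ∙ B ⊕ r ∙ B   ≈⟨ ≈-sym (∙-+ᵛ u r B) ⟩
      (u +ᵛ r) ∙ B    ≈⟨ ∙-normal-form (u +ᵛ r) (v +ᵛ l) certificate B ⟩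
      (v +ᵛ l) ∙ B    ≈⟨ ∙-+ᵛ v l B ⟩
      v ∙ B ⊕ l ∙ B   ≈⟨ ⊕-cong (≈-refl {v ∙ B}) e ⟩
      v ∙ B ⊕ r ∙ B   ∎)

module XYRecurrences where

  open PowerSeries
  open LinearCombinations
  open import Data.Nat using (ℕ; zero; suc)
  open import Data.Integer using (+_; _+_; _*_)
  open import Data.Integer.Properties using (+-identityʳ; *-identityˡ; *-zeroʳ)
  open import Data.Integer.Tactic.RingSolver using (solve-∀)
  open import Data.Vec using (Vec; []; _∷_)
  open import Relation.Binary.PropositionalEquality

  xy : Poly
  xy = X *ₚ Y

  xy⋆-suc : ∀ F n k ℓ → (xy ⋆ F) (suc n) (suc k) ℓ ≡ F n k ℓ
  xy⋆-suc F n k ℓ = trans (+-identityʳ _) (*-identityˡ _)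

  -- The coefficient of xⁿ in xy ⋆ E only involves that of xⁿ⁻¹ in E: induction on n.
  xy-recurrence-unique : ∀ (E H K : ℕ → Series) →
    (∀ g → E g ≈ xy ⋆ E (suc g) ⊕ K g) → (∀ g → H g ≈ xy ⋆ H (suc g) ⊕ K g) → ∀ g → E g ≈ H g
  xy-recurrence-unique E H K recE recH g n k ℓ = agree n g k ℓ
    where
    agree : ∀ n g k ℓ → E g n k ℓ ≡ H g n k ℓ
    agree n g k ℓ = trans (recE g n k ℓ) (trans (cong (_+ K g n k ℓ) (lower n k)) (sym (recH g n k ℓ)))
      where
      lower : ∀ n k → (xy ⋆ E (suc g)) n k ℓ ≡ (xy ⋆ H (suc g)) n k ℓ
      lower zero    k       = refl
      lower (suc n) zero    = refl
      lower (suc n) (suc k) =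
        trans (xy⋆-suc (E (suc g)) n k ℓ) (trans (agree n (suc g) k ℓ) (sym (xy⋆-suc (H (suc g)) n k ℓ)))

  1-xy [1-xy]² : Poly
  1-xy   = ONE -ₚ xy
  [1-xy]² = 1-xy *ₚ 1-xy

  -- The ansatz (1 - xy)² G g = A + g B turns the recurrence into B = (1 - xy) S and
  -- A = (1 - xy) R + xy S; both sides then satisfy the same xy-recurrence.
  xy-recurrence-solution : ∀ (G : ℕ → Series) R S →
    (∀ g → G g ≈ xy ⋆ G (suc g) ⊕ R ⊕ g ·ˢ S) →
    ∀ g → [1-xy]² ⋆ G g ≈ 1-xy ⋆ (R ⊕ g ·ˢ S) ⊕ xy ⋆ S
  xy-recurrence-solution G R S rec = xy-recurrence-unique E H K recE recH
    where
    open import Relation.Binary.Reasoning.Setoid ≈-setoid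
    W : ℕ → Series
    W g = R ⊕ g ·ˢ S
    E H K : ℕ → Series
    E g = [1-xy]² ⋆ G g
    H g = 1-xy ⋆ W g ⊕ xy ⋆ S
    K g = [1-xy]² ⋆ W g

    recE : ∀ g → E g ≈ xy ⋆ E (suc g) ⊕ K g
    recE g = begin
      [1-xy]² ⋆ G g
        ≈⟨ ⋆-cong [1-xy]² (≈-trans (rec g) (⊕-assoc (xy ⋆ G (suc g)) R (g ·ˢ S))) ⟩
      [1-xy]² ⋆ (xy ⋆ G (suc g) ⊕ W g)   ≈⟨ ⋆-⊕ [1-xy]² (xy ⋆ G (suc g)) (W g) ⟩
      [1-xy]² ⋆ (xy ⋆ G (suc g)) ⊕ K g   ≈⟨ ⊕-cong commute (≈-refl {K g}) ⟩
      xy ⋆ E (suc g) ⊕ K g               ∎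
      where
      commute : [1-xy]² ⋆ (xy ⋆ G (suc g)) ≈ xy ⋆ ([1-xy]² ⋆ G (suc g))
      commute = ≈-trans (≈-sym (⋆-*ₚ [1-xy]² xy (G (suc g))))
               (≈-trans (⋆-normal-form ([1-xy]² *ₚ xy) (xy *ₚ [1-xy]²) refl (G (suc g)))
                        (⋆-*ₚ xy [1-xy]² (G (suc g))))

    recH : ∀ g → H g ≈ xy ⋆ H (suc g) ⊕ K g
    recH g = begin
      H g                                      ≈⟨ H-basis ⟩
      h ∙ T                                    ≈⟨ ∙-normal-form h (xy *ᵛ h′ +ᵛ k) refl T ⟩
      (xy *ᵛ h′ +ᵛ k) ∙ T                      ≈⟨ ∙-+ᵛ (xy *ᵛ h′) k T ⟩
      (xy *ᵛ h′) ∙ T ⊕ k ∙ T                   ≈⟨ ⊕-cong (∙-*ᵛ xy h′ T) K-basis ⟩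
      xy ⋆ (h′ ∙ T) ⊕ K g                      ≈⟨ ⊕-cong (⋆-cong xy H′-basis) (≈-refl {K g}) ⟩
      xy ⋆ H (suc g) ⊕ K g                     ∎
      where
      T : Vec Series 2
      T = W g ∷ S ∷ []
      h h′ k : Vec Poly 2
      h  = 1-xy ∷ xy ∷ []
      h′ = 1-xy ∷ 1-xy +ₚ xy ∷ []
      k  = [1-xy]² ∷ 0ₚ ∷ []
      H-basis : H g ≈ h ∙ T
      H-basis n k ℓ = cong (λ z → (1-xy ⋆ W g) n k ℓ + z) (sym (+-identityʳ _))
      K-basis : k ∙ T ≈ K g
      K-basis n k ℓ = +-identityʳ _
      H′-basis : h′ ∙ T ≈ H (suc g)
      H′-basis n k ℓ =
        trans (cong (λ z → (1-xy ⋆ W g) n k ℓ + (z + + 0)) (⋆-++ 1-xy xy S n k ℓ))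
       (trans (regroup ((1-xy ⋆ W g) n k ℓ) ((1-xy ⋆ S) n k ℓ) ((xy ⋆ S) n k ℓ))
              (cong (_+ (xy ⋆ S) n k ℓ) (sym (trans (⋆-cong 1-xy W-suc n k ℓ) (⋆-⊕ 1-xy (W g) S n k ℓ)))))
        where
        regroup : ∀ a c b → a + ((c + b) + + 0) ≡ (a + c) + b
        regroup = solve-∀
        W-suc : W (suc g) ≈ W g ⊕ S
        W-suc n k ℓ = expand (R n k ℓ) (+ g) (S n k ℓ)
          where
          expand : ∀ r g s → r + s * (+ 1 + g) ≡ (r + s * g) + s
          expand = solve-∀

  xy-recurrence-solution₀ : ∀ {m} (G : ℕ → Series) (B : Vec Series m) (ρ σ : Vec Poly m) →
    (∀ g → G g ≈ xy ⋆ G (suc g) ⊕ ρ ∙ B ⊕ g ·ˢ (σ ∙ B)) →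
    [1-xy]² ⋆ G 0 ≈ (1-xy *ᵛ ρ +ᵛ xy *ᵛ σ) ∙ B
  xy-recurrence-solution₀ G B ρ σ rec = begin
    [1-xy]² ⋆ G 0                               ≈⟨ xy-recurrence-solution G (ρ ∙ B) (σ ∙ B) rec 0 ⟩
    1-xy ⋆ (ρ ∙ B ⊕ 0 ·ˢ σ ∙ B) ⊕ xy ⋆ σ ∙ B   ≈⟨ ⊕-cong (⋆-cong 1-xy drop-0·) (≈-refl {xy ⋆ σ ∙ B}) ⟩
    1-xy ⋆ ρ ∙ B ⊕ xy ⋆ σ ∙ B                  ≈⟨ ≈-sym (⊕-cong (∙-*ᵛ 1-xy ρ B) (∙-*ᵛ xy σ B)) ⟩
    (1-xy *ᵛ ρ) ∙ B ⊕ (xy *ᵛ σ) ∙ B            ≈⟨ ≈-sym (∙-+ᵛ (1-xy *ᵛ ρ) (xy *ᵛ σ) B) ⟩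
    (1-xy *ᵛ ρ +ᵛ xy *ᵛ σ) ∙ B                 ∎
    where
    open import Relation.Binary.Reasoning.Setoid ≈-setoid
    drop-0· : ρ ∙ B ⊕ 0 ·ˢ σ ∙ B ≈ ρ ∙ B
    drop-0· n k ℓ =
      trans (cong (λ z → (ρ ∙ B) n k ℓ + z) (*-zeroʳ ((σ ∙ B) n k ℓ))) (+-identityʳ ((ρ ∙ B) n k ℓ))

  -- Constant families: F = xy F + (1 - xy) F.
  1-xy-cancel : ∀ {F G} → 1-xy ⋆ F ≈ 1-xy ⋆ G → F ≈ G
  1-xy-cancel {F} {G} e = xy-recurrence-unique (λ _ → F) (λ _ → G) (λ _ → 1-xy ⋆ F) split-F
    (λ _ → ≈-trans (split G) (⊕-cong (≈-refl {xy ⋆ G}) (≈-sym e))) 0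
    where
    split : ∀ F → F ≈ xy ⋆ F ⊕ 1-xy ⋆ F
    split F = ≈-trans (≈-sym (ONE-⋆ F)) (≈-trans (⋆-normal-form ONE (xy +ₚ 1-xy) refl F) (⋆-++ xy 1-xy F))
    split-F : ∀ g → F ≈ xy ⋆ F ⊕ 1-xy ⋆ F
    split-F _ = split F

module GeneratingFunction where

  open PowerSeries
  open LinearCombinations
  open XYRecurrences
  open ValleyCounting using (countAfterUp; countPaths; landingsBelowTop; aND≡countPaths)
  open import Data.Nat as ℕ using (ℕ; zero; suc)
  open import Data.Integer using (+_; _+_; _*_)
  open import Data.Integer.Properties using (pos-*)
  open import Data.Integer.Tactic.RingSolver using (solve-∀)
  open import Data.Bool using (true; false)
  open import Data.Vec using (Vec; []; _∷_)
  open import Relation.Binary.PropositionalEquality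
  open import Data.Fin using (#_)
  open import Function using (_∘_)

  -- Generating functions (x: length, y: steps U, z: steps D₁) of the suffixes after an up-step,
  -- when the last valley is above, resp. on, the ground.
  F F₀ : ℕ → Series
  F  g n k ℓ = + countAfterUp false g n k ℓ
  F₀ g n k ℓ = + countAfterUp true  g n k ℓ

  basis : Vec Series 4
  basis = δ ∷ F 0 ∷ F₀ 0 ∷ F₀ 1 ∷ []

  e₀ e₁ e₂ e₃ : Poly → Vec Poly 4
  e₀ p = p  ∷ 0ₚ ∷ 0ₚ ∷ 0ₚ ∷ []
  e₁ p = 0ₚ ∷ p  ∷ 0ₚ ∷ 0ₚ ∷ []
  e₂ p = 0ₚ ∷ 0ₚ ∷ p  ∷ 0ₚ ∷ []
  e₃ p = 0ₚ ∷ 0ₚ ∷ 0ₚ ∷ p  ∷ []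

  x²y x²yz xz : Poly
  x²y  = X *ₚ xy
  x²yz = x²y *ₚ Z
  xz   = X *ₚ Z

  ρ ρ₀ σ : Vec Poly 4
  ρ  = X ∷ x²yz ∷ 0ₚ  ∷ 0ₚ ∷ []
  ρ₀ = X ∷ x²yz ∷ x²y ∷ 0ₚ ∷ []
  σ  = 0ₚ ∷ x²y ∷ 0ₚ ∷ 0ₚ ∷ []

  landingsBelowTop-false : ∀ g r k ℓ → landingsBelowTop false g r k ℓ ≡ g ℕ.* countAfterUp false 0 r k ℓ
  landingsBelowTop-false zero    r k ℓ = refl
  landingsBelowTop-false (suc g) r k ℓ = refl

  -- At the coefficient (r + 2, k + 1, ℓ), the right-hand sides of the recurrences below compute to
  -- the right-hand sides of these identities; all other coefficients agree by computation alone.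
  F-coefficient : ∀ u b l g → + (u ℕ.+ (g ℕ.* b ℕ.+ l)) ≡
    (+ 1 * + u + + 0) + (+ 0 + ((+ 1 * + l + + 0) + + 0)) + (+ 0 + ((+ 1 * + b + + 0) + + 0)) * + g
  F-coefficient u b l g = trans (cong (λ w → + u + (w + + l)) (pos-* g b)) (shape (+ u) (+ b) (+ l) (+ g))
    where
    shape : ∀ u b l g → u + (g * b + l) ≡
      (+ 1 * u + + 0) + (+ 0 + ((+ 1 * l + + 0) + + 0)) + (+ 0 + ((+ 1 * b + + 0) + + 0)) * g
    shape = solve-∀

  F₀-coefficient : ∀ u z b l h → + (u ℕ.+ ((z ℕ.+ h ℕ.* b) ℕ.+ l)) ≡
    (+ 1 * + u + + 0) + (+ 0 + ((+ 1 * + l + + 0) + ((+ 1 * + z + + 0) + + 0))) + (+ 0 + ((+ 1 * + b + + 0) + + 0)) * + h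
  F₀-coefficient u z b l h = trans (cong (λ w → + u + ((+ z + w) + + l)) (pos-* h b)) (shape (+ u) (+ z) (+ b) (+ l) (+ h))
    where
    shape : ∀ u z b l h → u + ((z + h * b) + l) ≡
      (+ 1 * u + + 0) + (+ 0 + ((+ 1 * l + + 0) + ((+ 1 * z + + 0) + + 0))) + (+ 0 + ((+ 1 * b + + 0) + + 0)) * h
    shape = solve-∀

  F₀0-coefficient : ∀ u l → u + l ≡ + 0 + (+ 0 + ((+ 1 * l + + 0) + ((+ 1 * u + + 0) + + 0)))
  F₀0-coefficient = solve-∀

  F-recurrence : ∀ g → F g ≈ xy ⋆ F (suc g) ⊕ ρ ∙ basis ⊕ g ·ˢ σ ∙ basis
  F-recurrence g zero          k       ℓ       = refl
  F-recurrence g (suc zero)    zero    zero    = refl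
  F-recurrence g (suc zero)    zero    (suc ℓ) = refl
  F-recurrence g (suc zero)    (suc k) ℓ       = refl
  F-recurrence g (suc (suc r)) zero    ℓ       = refl
  F-recurrence g (suc (suc r)) (suc k) zero    =
    trans (cong (λ b → + (countAfterUp false (suc g) (suc r) k 0 ℕ.+ (b ℕ.+ 0))) (landingsBelowTop-false g r k 0))
          (F-coefficient (countAfterUp false (suc g) (suc r) k 0) (countAfterUp false 0 r k 0) 0 g)
  F-recurrence g (suc (suc r)) (suc k) (suc ℓ) =
    trans (cong (λ b → + (countAfterUp false (suc g) (suc r) k (suc ℓ) ℕ.+ (b ℕ.+ countAfterUp false 0 r k ℓ)))
                (landingsBelowTop-false g r k (suc ℓ)))
          (F-coefficient (countAfterUp false (suc g) (suc r) k (suc ℓ)) (countAfterUp false 0 r k (suc ℓ))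
                         (countAfterUp false 0 r k ℓ) g)

  F₀-recurrence : ∀ h → F₀ (suc h) ≈ xy ⋆ F₀ (suc (suc h)) ⊕ ρ₀ ∙ basis ⊕ h ·ˢ σ ∙ basis
  F₀-recurrence h zero          k       ℓ       = refl
  F₀-recurrence h (suc zero)    zero    zero    = refl
  F₀-recurrence h (suc zero)    zero    (suc ℓ) = refl
  F₀-recurrence h (suc zero)    (suc k) ℓ       = refl
  F₀-recurrence h (suc (suc r)) zero    ℓ       = refl
  F₀-recurrence h (suc (suc r)) (suc k) zero    =
    F₀-coefficient (countAfterUp true (suc (suc h)) (suc r) k 0) (countAfterUp true 0 r k 0)
                   (countAfterUp false 0 r k 0) 0 h
  F₀-recurrence h (suc (suc r)) (suc k) (suc ℓ) =
    F₀-coefficient (countAfterUp true (suc (suc h)) (suc r) k (suc ℓ)) (countAfterUp true 0 r k (suc ℓ))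
                   (countAfterUp false 0 r k (suc ℓ)) (countAfterUp false 0 r k ℓ) h

  F₀-recurrence₀ : F₀ 0 ≈ (xz ∷ 0ₚ ∷ x²yz ∷ xy ∷ []) ∙ basis
  F₀-recurrence₀ zero k ℓ = refl
  F₀-recurrence₀ (suc zero) zero zero = refl
  F₀-recurrence₀ (suc zero) zero (suc zero) = refl
  F₀-recurrence₀ (suc zero) zero (suc (suc ℓ)) = refl
  F₀-recurrence₀ (suc zero) (suc k) zero = refl
  F₀-recurrence₀ (suc zero) (suc k) (suc ℓ) = refl
  F₀-recurrence₀ (suc (suc r)) zero zero = refl
  F₀-recurrence₀ (suc (suc r)) zero (suc ℓ) = refl
  F₀-recurrence₀ (suc (suc r)) (suc k) zero    = F₀0-coefficient (+ countAfterUp true 1 (suc r) k 0) (+ 0)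
  F₀-recurrence₀ (suc (suc r)) (suc k) (suc ℓ) =
    F₀0-coefficient (+ countAfterUp true 1 (suc r) k (suc ℓ)) (+ countAfterUp true 0 r k ℓ)

  A : Series
  A n k ℓ = + aND n k ℓ

  A-basis : A ≈ e₂ xy ∙ basis
  A-basis n k ℓ = trans (cong +_ (aND≡countPaths n k ℓ)) (first-step n k)
    where
    first-step : ∀ n k → + countPaths n k ℓ ≡ (e₂ xy ∙ basis) n k ℓ
    first-step zero    k       = refl
    first-step (suc r) zero    = refl
    first-step (suc r) (suc k) = shape (+ countAfterUp true 0 r k ℓ)
      where
      shape : ∀ z → z ≡ + 0 + (+ 0 + ((+ 1 * z + + 0) + + 0))
      shape = solve-∀

  F0-equation : e₁ [1-xy]² ∙ basis ≈ (1-xy *ᵛ ρ +ᵛ xy *ᵛ σ) ∙ basis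
  F0-equation = ≈-trans (∙-unit (# 1) [1-xy]² basis) (xy-recurrence-solution₀ F basis ρ σ F-recurrence)

  F₀1-equation : e₃ [1-xy]² ∙ basis ≈ (1-xy *ᵛ ρ₀ +ᵛ xy *ᵛ σ) ∙ basis
  F₀1-equation =
    ≈-trans (∙-unit (# 3) [1-xy]² basis) (xy-recurrence-solution₀ (F₀ ∘ suc) basis ρ₀ σ F₀-recurrence)

  F₀0-equation : e₂ ONE ∙ basis ≈ (xz ∷ 0ₚ ∷ x²yz ∷ xy ∷ []) ∙ basis
  F₀0-equation = ≈-trans (∙-unit (# 2) ONE basis) (≈-trans (ONE-⋆ (F₀ 0)) F₀-recurrence₀)

  -- F0-equation reads d F 0 = (1 - xy) x, and (1 - xy) D xy = d xy ((1 - xy)² (1 - x²yz) - xy (1 - xy) x²y);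
  -- the multipliers cᵢ eliminate F₀ 0, F₀ 1 and F 0 from (1 - xy) D A = (1 - xy) D xy F₀ 0.
  -- The implicit series arguments of ⋆-cong are supplied: inferring them would unfold the products
  -- coefficientwise.
  denominator⋆A≈numerator : (denom1 *ₚ denom2) ⋆ A ≈ numerator ⋆ δ
  denominator⋆A≈numerator = 1-xy-cancel (begin
    1-xy ⋆ (D ⋆ A)
      ≈⟨ ⋆-cong 1-xy {D ⋆ A} {(D *ᵛ e₂ xy) ∙ basis} D⋆A ⟩
    1-xy ⋆ (D *ᵛ e₂ xy) ∙ basis
      ≈⟨ ≈-sym (∙-*ᵛ 1-xy (D *ᵛ e₂ xy) basis) ⟩
    (1-xy *ᵛ D *ᵛ e₂ xy) ∙ basis
      ≈⟨ ∙-by-relation basis (l₁ +ᵛ l₂ +ᵛ l₃) (r₁ +ᵛ r₂ +ᵛ r₃) (1-xy *ᵛ D *ᵛ e₂ xy) (e₀ (1-xy *ₚ numerator))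
                       eliminate refl ⟩
    e₀ (1-xy *ₚ numerator) ∙ basis
      ≈⟨ ∙-unit (# 0) (1-xy *ₚ numerator) basis ⟩
    (1-xy *ₚ numerator) ⋆ δ
      ≈⟨ ⋆-*ₚ 1-xy numerator δ ⟩
    1-xy ⋆ (numerator ⋆ δ)        ∎)
    where
    open import Relation.Binary.Reasoning.Setoid ≈-setoid
    D k₀ d c₁ c₂ c₃ : Poly
    D  = denom1 *ₚ denom2
    k₀ = 1-xy *ₚ x²yz +ₚ xy *ₚ x²y
    d  = [1-xy]² -ₚ k₀
    c₁ = xy *ₚ xy *ₚ k₀
    c₂ = xy *ₚ xy *ₚ d
    c₃ = [1-xy]² *ₚ xy *ₚ d
    D⋆A : D ⋆ A ≈ (D *ᵛ e₂ xy) ∙ basis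
    D⋆A = ≈-trans (⋆-cong D {A} {e₂ xy ∙ basis} A-basis) (≈-sym (∙-*ᵛ D (e₂ xy) basis))
    l₁ r₁ l₂ r₂ l₃ r₃ : Vec Poly 4
    l₁ = c₁ *ᵛ e₁ [1-xy]²
    r₁ = c₁ *ᵛ (1-xy *ᵛ ρ +ᵛ xy *ᵛ σ)
    l₂ = c₂ *ᵛ e₃ [1-xy]²
    r₂ = c₂ *ᵛ (1-xy *ᵛ ρ₀ +ᵛ xy *ᵛ σ)
    l₃ = c₃ *ᵛ e₂ ONE
    r₃ = c₃ *ᵛ (xz ∷ 0ₚ ∷ x²yz ∷ xy ∷ [])
    eliminate : (l₁ +ᵛ l₂ +ᵛ l₃) ∙ basis ≈ (r₁ +ᵛ r₂ +ᵛ r₃) ∙ basis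
    eliminate = ∙-relation-+ᵛ basis (l₁ +ᵛ l₂) (r₁ +ᵛ r₂) l₃ r₃
      (∙-relation-+ᵛ basis l₁ r₁ l₂ r₂
        (∙-relation-*ᵛ basis c₁ (e₁ [1-xy]²) (1-xy *ᵛ ρ +ᵛ xy *ᵛ σ) F0-equation)
        (∙-relation-*ᵛ basis c₂ (e₃ [1-xy]²) (1-xy *ᵛ ρ₀ +ᵛ xy *ᵛ σ) F₀1-equation))
      (∙-relation-*ᵛ basis c₃ (e₂ ONE) (xz ∷ 0ₚ ∷ x²yz ∷ xy ∷ []) F₀0-equation)

open PowerSeries using (_⋆_; δ; mulSeries-⋆; coeff-⋆)
open GeneratingFunction using (A; denominator⋆A≈numerator)
open ≡-Reasoning

theorem10 : (n k ℓ : ℕ) →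
    mulSeries (denom1 *ₚ denom2) aND n k ℓ ≡ coeff numerator n k ℓ
theorem10 n k ℓ = begin
  mulSeries (denom1 *ₚ denom2) aND n k ℓ  ≡⟨ mulSeries-⋆ (denom1 *ₚ denom2) aND n k ℓ ⟩
  ((denom1 *ₚ denom2) ⋆ A) n k ℓ          ≡⟨ denominator⋆A≈numerator n k ℓ ⟩
  (numerator ⋆ δ) n k ℓ                   ≡⟨ coeff-⋆ numerator n k ℓ ⟨
  coeff numerator n k ℓ                   ∎
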